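{- Let $\varphi$ be a 3CNF formula and $\mathcal{P}_\varphi$ the system constructed from it. If $\varphi$ is not satisfiable, then $e\in\mathit{first}(w)$ for every full run $w$ of $\mathrm{TS}(\mathcal{P}_\varphi)$ (in other words, all full runs start with $e$ up to trace equivalence).
   Context: Let $\varphi=(\alpha^1_1\lor\alpha^1_2\lor\alpha^1_3)\land\dots\land(\alpha^k_1\lor\alpha^k_2\lor\alpha^k_3)$ be a 3CNF formula over variables $x_1,\dots,x_n$, each $\alpha^j_i$ a literal $x_m$ or $\bar x_m$. The system $\mathcal{P}_\varphi$ is a finite collection of transition systems synchronizing on common actions, with actions $\theta_i,\lambda_i,\bar\theta_i,\bar\lambda_i,x_i,\bar x_i$ ($i=1,\dots,n$), $e,\bar e,b$, and the processes: - For each $i$, $C_i$ with states top, bottom: top $\xrightarrow{\theta_i}$ bottom, top $\xrightarrow{\lambda_i}$ bottom, bottom $\xrightarrow{x_i}$ bottom; and $\bar C_i$ likewise with $\bar\theta_i,\bar\lambda_i,\bar x_i$. Initially in top. - $C^*$ with a single transition labelled $e$; $\bar C^*$ with a path $\xrightarrow{b}\xrightarrow{\bar e}$. - $S_l$: states $l_0,\dots,l_{n+1}$, with $l_0\xrightarrow{e}l_1$, $l_0\xrightarrow{\bar e}l_1$, and $l_i\xrightarrow{\lambda_i}l_{i+1}$, $l_i\xrightarrow{\bar\lambda_i}l_{i+1}$ for $i=1,\dots,n$; initially $l_0$. - $S_r$: states $r_0,\dots,r_{n+k+1}$, with $r_{i-1}\xrightarrow{\theta_i}r_i$, $r_{i-1}\xrightarrow{\bar\theta_i}r_i$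 for $i=1,\dots,n$; for $j=1,\dots,k$, transitions from $r_{n+j-1}$ to $r_{n+j}$ labelled by the action of each literal $\alpha^j_1,\alpha^j_2,\alpha^j_3$ of clause $j$ (literal $x_m$ gives action $x_m$, literal $\bar x_m$ gives action $\bar x_m$); and $r_{n+k}\xrightarrow{b}r_{n+k+1}$; initially $r_0$. $\mathit{dom}(a)$ is the set of processes having $a$ in their alphabet (every action belongs to exactly two processes). The global transition system $\mathrm{TS}(\mathcal{P}_\varphi)$ has states the tuples of local states, initial state the tuple of initial states, and $s\xrightarrow{a}s'$ iff every process in $\mathit{dom}(a)$ takes an $a$-transition and the others stay put. A full run is a path from the initial state to a state without outgoing transitions. Actions are independent if their domains are disjoint; $u\sim w$ if $w$ is obtained from $u$ by swapping adjacent independent actions; $\mathit{first}(u)=\{c:\exists v.\ cv\sim u\}$. -}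

module Defs where

open import Data.Nat using (ℕ; zero; suc; _+_)
open import Data.Fin using (Fin; toℕ)
open import Data.Bool using (Bool; true; false; not; if_then_else_)
open import Data.Product using (_×_; _,_; ∃; Σ)
open import Data.Empty using (⊥)
open import Data.Unit using (⊤)
open import Data.List using (List; []; _∷_; _++_)
open import Relation.Nullary using (¬_)
open import Relation.Binary.PropositionalEquality using (_≡_)
open import Relation.Binary.Construct.Closure.ReflexiveTransitive using (Star)

record System (Act : Set) : Set₁ where
  field
    Proc  : Set
    State : Proc → Set
    init  : (p : Proc) → State p
    alph  : Proc → Act → Set
    trans : (p : Proc) → State p → Act → State p → Set

module _ {Act : Set} (S : System Act) where
  open System S

  GState : Set
  GState = (p : Proc) → State p

  initG : GState
  initG = init

  Step : GState → Act → GState → Set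
  Step s a s' = (p : Proc) → (alph p a → trans p (s p) a (s' p)) × (¬ alph p a → s' p ≡ s p)

  data Path : GState → List Act → GState → Set where
    []  : ∀ {s} → Path s [] s
    _∷_ : ∀ {s a s' w t} → Step s a s' → Path s' w t → Path s (a ∷ w) t

  Terminal : GState → Set
  Terminal s = ∀ a s' → ¬ Step s a s'

  FullRun : List Act → Set
  FullRun w = ∃ λ t → Path initG w t × Terminal t

  Independent : Act → Act → Set
  Independent a c = ∀ p → ¬ (alph p a × alph p c)

  data Swap : List Act → List Act → Set where
    swap : ∀ u a c v → Independent a c → Swap (u ++ a ∷ c ∷ v) (u ++ c ∷ a ∷ v)

  -- trace equivalence (Swap is symmetric, so its refl.-trans. closure is the equivalence)
  _∼_ : List Act → List Act → Set
  _∼_ = Star Swap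

  first : List Act → Act → Set
  first u c = ∃ λ v → (c ∷ v) ∼ u

-- 3CNF formulas over x_1..x_n with k clauses (variables 0-indexed by Fin n)

-- literal (m , true) = x_m, (m , false) = x̄_m
Literal : ℕ → Set
Literal n = Fin n × Bool

Formula : ℕ → ℕ → Set
Formula n k = Fin k → Fin 3 → Literal n

litVal : ∀ {n} → (Fin n → Bool) → Literal n → Bool
litVal ν (m , pol) = if pol then ν m else not (ν m)

Satisfiable : ∀ {n k} → Formula n k → Set
Satisfiable {n} {k} φ = ∃ λ (ν : Fin n → Bool) → ∀ (j : Fin k) → ∃ λ (i : Fin 3) → litVal ν (φ j i) ≡ true

-- The system P_φ.  Polarity true = unbarred, false = barred.

data Act (n : ℕ) : Set where
  θ   : Fin n → Bool → Act n
  lam : Fin n → Bool → Act n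
  x   : Fin n → Bool → Act n
  e   : Act n
  ē   : Act n
  b   : Act n

data Proc (n : ℕ) : Set where
  C     : Fin n → Bool → Proc n
  Cstar : Proc n
  C̄star : Proc n
  Sl    : Proc n
  Sr    : Proc n

data TB : Set where
  top bottom : TB

PState : (n k : ℕ) → Proc n → Set
PState n k (C _ _) = TB
PState n k Cstar   = Fin 2
PState n k C̄star   = Fin 3
PState n k Sl      = Fin (suc (suc n))          -- l_0 .. l_{n+1}
PState n k Sr      = Fin (suc (suc (n + k)))    -- r_0 .. r_{n+k+1}

PInit : (n k : ℕ) → (p : Proc n) → PState n k p
PInit n k (C _ _) = top
PInit n k Cstar   = Data.Fin.zero
PInit n k C̄star   = Data.Fin.zero
PInit n k Sl      = Data.Fin.zero
PInit n k Sr      = Data.Fin.zero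

PAlph : ∀ {n} → Proc n → Act n → Set
PAlph (C i p) (θ j q)   = j ≡ i × q ≡ p
PAlph (C i p) (lam j q) = j ≡ i × q ≡ p
PAlph (C i p) (x j q)   = j ≡ i × q ≡ p
PAlph (C i p) _         = ⊥
PAlph Cstar e           = ⊤
PAlph Cstar _           = ⊥
PAlph C̄star b           = ⊤
PAlph C̄star ē           = ⊤
PAlph C̄star _           = ⊥
PAlph Sl e              = ⊤
PAlph Sl ē              = ⊤
PAlph Sl (lam _ _)      = ⊤
PAlph Sl _              = ⊥
PAlph Sr (θ _ _)        = ⊤
PAlph Sr (x _ _)        = ⊤
PAlph Sr b              = ⊤
PAlph Sr _              = ⊥

cTrans : ∀ {n} → TB → Act n → TB → Set
cTrans top    (θ _ _)   bottom = ⊤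
cTrans top    (lam _ _) bottom = ⊤
cTrans bottom (x _ _)   bottom = ⊤
cTrans _      _         _      = ⊥

PTrans : ∀ {n k} → Formula n k → (p : Proc n) → PState n k p → Act n → PState n k p → Set
PTrans φ (C i p) s a s' = PAlph (C i p) a × cTrans s a s'
PTrans φ Cstar s e s'   = toℕ s ≡ 0 × toℕ s' ≡ 1
PTrans φ Cstar s _ s'   = ⊥
PTrans φ C̄star s b s'   = toℕ s ≡ 0 × toℕ s' ≡ 1
PTrans φ C̄star s ē s'   = toℕ s ≡ 1 × toℕ s' ≡ 2
PTrans φ C̄star s _ s'   = ⊥
PTrans φ Sl s e s'      = toℕ s ≡ 0 × toℕ s' ≡ 1
PTrans φ Sl s ē s'      = toℕ s ≡ 0 × toℕ s' ≡ 1
-- l_i -λ_i-> l_{i+1}  (variable i is 1-based in the paper; here Fin n index m means x_{m+1})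
PTrans φ Sl s (lam m _) s' = toℕ s ≡ suc (toℕ m) × toℕ s' ≡ suc (suc (toℕ m))
PTrans φ Sl s _ s'      = ⊥
PTrans φ Sr s (θ m _) s' = toℕ s ≡ toℕ m × toℕ s' ≡ suc (toℕ m)
PTrans {n} {k} φ Sr s (x m q) s' =
  ∃ λ (j : Fin k) → ∃ λ (i : Fin 3) →
    φ j i ≡ (m , q) × toℕ s ≡ n + toℕ j × toℕ s' ≡ suc (n + toℕ j)
PTrans {n} {k} φ Sr s b s' = toℕ s ≡ n + k × toℕ s' ≡ suc (n + k)
PTrans φ Sr s _ s'      = ⊥

P : ∀ {n k} → Formula n k → System (Act n)
P {n} {k} φ = record
  { Proc  = Proc n
  ; State = PState n k
  ; init  = PInit n k
  ; alph  = PAlph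
  ; trans = PTrans φ
  }

{-# OPTIONS --safe #-}
-- As long as neither e nor ē has fired, C*, C̄* and S_l are frozen (ē needs C̄* to do b
-- first, and λ_i needs S_l past l_0), so e stays enabled and the only other possible
-- actions are the θ's and x's, all independent of e. Along such a prefix the C processes
-- at bottom record a consistent partial valuation (θ_i fires only with S_r at r_{i-1},
-- so at most one of C_i, C̄_i drops), and S_r crosses clause j only through a literal
-- whose process is at bottom, hence true. So if S_r reached b, φ would be satisfiable.
-- For unsatisfiable φ a full run therefore cannot stop before e, and its first action
-- outside the θ's and x's is e, which commutes to the front.
module Submission where

open import Defs
open import Data.Bool using (Bool; true; false; not) renaming (_≟_ to _≟ᵇ_)
open import Data.Empty using (⊥-elim)
open import Data.Fin using (Fin; toℕ; zero; suc)
open import Data.Fin.Properties using (toℕ<n; toℕ-injective; <⇒≢; _≟_)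
open import Data.List using (List; []; _∷_)
open import Data.Nat as ℕ using (ℕ; _+_; _≤_; _<_; s≤s)
open import Data.Nat.Properties
  using (0≢1+n; ≤-refl; <⇒≤; <⇒≱; <-≤-trans; m≤m+n; m<n⇒m<1+n; m<1+n⇒m≤n;
         m<1+n⇒m<n∨m≡n; +-monoʳ-<; +-cancelˡ-≡)
open import Data.Product using (_×_; _,_; ∃; proj₁; proj₂)
open import Data.Sum using (_⊎_; inj₁; inj₂)
open import Data.Unit using (tt)
open import Data.Vec.Functional using (updateAt)
open import Data.Vec.Functional.Properties using (updateAt-updates; updateAt-minimal)
open import Function using (const)
open import Relation.Binary.Construct.Closure.ReflexiveTransitive using (ε; _◅_; gmap)
open import Relation.Binary.PropositionalEquality using (_≡_; refl; sym; trans; cong; subst)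
open import Relation.Nullary using (¬_; Dec; yes; no)
open import Relation.Nullary.Decidable using (_×-dec_)

module _ {A : Set} (S : System A) where
  open System S using (alph) renaming (trans to local)

  step-local : ∀ {s a s′} → Step S s a s′ → ∀ {p} → alph p a → local p (s p) a (s′ p)
  step-local st {p} = proj₁ (st p)

  step-frame : ∀ {s a s′} → Step S s a s′ → ∀ {p} → ¬ alph p a → s′ p ≡ s p
  step-frame st {p} = proj₂ (st p)

  step-local⊎frame : ∀ {s a s′} → Step S s a s′ → ∀ p → Dec (alph p a) →
                     local p (s p) a (s′ p) ⊎ s′ p ≡ s p
  step-local⊎frame st p (yes p∈a) = inj₁ (step-local st p∈a)
  step-local⊎frame st p (no p∉a)  = inj₂ (step-frame st p∉a)

  ∼-cons : ∀ a {u w} → _∼_ S u w → _∼_ S (a ∷ u) (a ∷ w)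
  ∼-cons a = gmap (a ∷_) λ { (swap u c d v c#d) → swap (a ∷ u) c d v c#d }

  first-cons : ∀ {a c w} → Independent S c a → first S w c → first S (a ∷ w) c
  first-cons {a} {c} c#a (v , cv∼w) = a ∷ v , swap [] c a v c#a ◅ ∼-cons a cv∼w

  invariant⇒first : (c : A) (I : GState S → Set) →
    (∀ {s} → I s → ∃ λ s′ → Step S s c s′) →
    (∀ {s a s′} → I s → Step S s a s′ → a ≡ c ⊎ Independent S c a × I s′) →
    ∀ {s w t} → I s → Path S s w t → Terminal S t → first S w c
  invariant⇒first c I enabled preserved = go
    where
    go : ∀ {s w t} → I s → Path S s w t → Terminal S t → first S w c
    go i []         terminal = ⊥-elim (terminal c _ (proj₂ (enabled i)))
    go i (st ∷ run) terminal with preserved i st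
    ... | inj₁ refl        = _ , ε
    ... | inj₂ (c#a , i′) = first-cons c#a (go i′ run terminal)

litVal-true : ∀ {n} (ν : Fin n → Bool) {m q} → ν m ≡ q → litVal ν (m , q) ≡ true
litVal-true ν {q = true}  νm≡q = νm≡q
litVal-true ν {q = false} νm≡q = cong not νm≡q

cTrans-x : ∀ {n} {t t′ : TB} {m q} → cTrans {n} t (x m q) t′ → t ≡ bottom × t′ ≡ bottom
cTrans-x {t = bottom} {bottom} _ = refl , refl

C-alph? : ∀ {n} (m : Fin n) q a → Dec (PAlph (C m q) a)
C-alph? m q (θ m′ q′)   = m′ ≟ m ×-dec q′ ≟ᵇ q
C-alph? m q (lam m′ q′) = m′ ≟ m ×-dec q′ ≟ᵇ q
C-alph? m q (x m′ q′)   = m′ ≟ m ×-dec q′ ≟ᵇ q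
C-alph? m q e           = no λ ()
C-alph? m q ē           = no λ ()
C-alph? m q b           = no λ ()

module _ {n k : ℕ} (φ : Formula n k) where

  Chosen : GState (P φ) → Literal n → Set
  Chosen s (m , q) = s (C m q) ≡ bottom

  Passed : GState (P φ) → Fin k → Set
  Passed s j = n + toℕ j < toℕ (s Sr)

  record BeforeE (s : GState (P φ)) : Set where
    field
      Sl-at-l₀             : s Sl ≡ zero
      C*-unfired           : s Cstar ≡ zero
      C̄*-unfired           : s C̄star ≡ zero
      valuation            : Fin n → Bool
      chosen-agrees        : ∀ {m q} → Chosen s (m , q) → valuation m ≡ q
      chosen-before-Sr     : ∀ {m q} → Chosen s (m , q) → toℕ m < toℕ (s Sr)
      passed-clause-chosen : ∀ {j} → Passed s j → ∃ λ i → Chosen s (φ j i)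

  open BeforeE

  initial-BeforeE : BeforeE (initG (P φ))
  initial-BeforeE = record
    { Sl-at-l₀             = refl
    ; C*-unfired           = refl
    ; C̄*-unfired           = refl
    ; valuation            = const true
    ; chosen-agrees        = λ ()
    ; chosen-before-Sr     = λ ()
    ; passed-clause-chosen = λ ()
    }

  fire-e : GState (P φ) → GState (P φ)
  fire-e s Cstar = suc zero
  fire-e s Sl    = suc zero
  fire-e s p     = s p

  e-enabled : ∀ {s} → BeforeE s → ∃ λ s′ → Step (P φ) s e s′
  e-enabled {s} inv = fire-e s , step
    where
    step : Step (P φ) s e (fire-e s)
    step (C _ _) = (λ ()) , λ _ → refl
    step Cstar   = (λ _ → cong toℕ (C*-unfired inv) , refl) , λ e∉ → ⊥-elim (e∉ tt)
    step C̄star   = (λ ()) , λ _ → refl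
    step Sl      = (λ _ → cong toℕ (Sl-at-l₀ inv) , refl) , λ e∉ → ⊥-elim (e∉ tt)
    step Sr      = (λ ()) , λ _ → refl

  e-independent : ∀ {a} → ¬ PAlph Cstar a → ¬ PAlph Sl a → Independent (P φ) e a
  e-independent a∉C* a∉Sl (C _ _) (() , _)
  e-independent a∉C* a∉Sl Cstar   (_ , a∈C*) = a∉C* a∈C*
  e-independent a∉C* a∉Sl C̄star   (() , _)
  e-independent a∉C* a∉Sl Sl      (_ , a∈Sl) = a∉Sl a∈Sl
  e-independent a∉C* a∉Sl Sr      (() , _)

  θ-chooses : ∀ {s s′ m q m′ q′} → Step (P φ) s (θ m q) s′ → Chosen s′ (m′ , q′) →
              Chosen s (m′ , q′) ⊎ (m ≡ m′ × q ≡ q′)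
  θ-chooses {m = m} {q} {m′} {q′} st chosen
    with step-local⊎frame (P φ) st (C m′ q′) (C-alph? m′ q′ (θ m q))
  ... | inj₁ (same , _) = inj₂ same
  ... | inj₂ unchanged  = inj₁ (trans (sym unchanged) chosen)

  x-keeps-C : ∀ {s s′ m q} → Step (P φ) s (x m q) s′ → ∀ m′ q′ → s′ (C m′ q′) ≡ s (C m′ q′)
  x-keeps-C {m = m} {q} st m′ q′
    with step-local⊎frame (P φ) st (C m′ q′) (C-alph? m′ q′ (x m q))
  ... | inj₁ (_ , loop) = let t≡⊥ , t′≡⊥ = cTrans-x loop in trans t′≡⊥ (sym t≡⊥)
  ... | inj₂ unchanged  = unchanged

  θ-preserves : ∀ {s s′ m q} → Step (P φ) s (θ m q) s′ → BeforeE s → BeforeE s′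
  θ-preserves {s} {s′} {m} {q} st inv = record
    { Sl-at-l₀             = trans (step-frame (P φ) st (λ ())) (Sl-at-l₀ inv)
    ; C*-unfired           = trans (step-frame (P φ) st (λ ())) (C*-unfired inv)
    ; C̄*-unfired           = trans (step-frame (P φ) st (λ ())) (C̄*-unfired inv)
    ; valuation            = ν′
    ; chosen-agrees        = agrees
    ; chosen-before-Sr     = λ chosen → subst (_ <_) (sym Sr′≡1+m) (s≤s (not-ahead chosen))
    ; passed-clause-chosen = λ passed → ⊥-elim (no-clause-passed passed)
    }
    where
    Sr≡m : toℕ (s Sr) ≡ toℕ m
    Sr≡m = proj₁ (step-local (P φ) st {Sr} tt)

    Sr′≡1+m : toℕ (s′ Sr) ≡ ℕ.suc (toℕ m)
    Sr′≡1+m = proj₂ (step-local (P φ) st {Sr} tt)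

    ν′ : Fin n → Bool
    ν′ = updateAt (valuation inv) m (const q)

    behind : ∀ {m′ q′} → Chosen s (m′ , q′) → toℕ m′ < toℕ m
    behind chosen = subst (_ <_) Sr≡m (chosen-before-Sr inv chosen)

    not-ahead : ∀ {m′ q′} → Chosen s′ (m′ , q′) → toℕ m′ ≤ toℕ m
    not-ahead chosen with θ-chooses st chosen
    ... | inj₁ old        = <⇒≤ (behind old)
    ... | inj₂ (refl , _) = ≤-refl

    agrees : ∀ {m′ q′} → Chosen s′ (m′ , q′) → ν′ m′ ≡ q′
    agrees chosen with θ-chooses st chosen
    ... | inj₁ old           = trans (updateAt-minimal _ m (valuation inv) (<⇒≢ (behind old)))
                                     (chosen-agrees inv old)
    ... | inj₂ (refl , refl) = updateAt-updates m (valuation inv)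

    no-clause-passed : ∀ {j} → ¬ Passed s′ j
    no-clause-passed {j} passed =
      <⇒≱ (<-≤-trans (toℕ<n m) (m≤m+n n (toℕ j))) (m<1+n⇒m≤n (subst (_ <_) Sr′≡1+m passed))

  x-preserves : ∀ {s s′ m q} → Step (P φ) s (x m q) s′ → BeforeE s → BeforeE s′
  x-preserves {s} {s′} {m} {q} st inv with step-local (P φ) st {Sr} tt
  ... | j₀ , i₀ , φj₀i₀≡mq , Sr≡n+j₀ , Sr′≡1+n+j₀ = record
    { Sl-at-l₀             = trans (step-frame (P φ) st (λ ())) (Sl-at-l₀ inv)
    ; C*-unfired           = trans (step-frame (P φ) st (λ ())) (C*-unfired inv)
    ; C̄*-unfired           = trans (step-frame (P φ) st (λ ())) (C̄*-unfired inv)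
    ; valuation            = valuation inv
    ; chosen-agrees        = λ chosen → chosen-agrees inv (still⁻¹ chosen)
    ; chosen-before-Sr     = λ chosen → subst (_ <_) (sym Sr′≡1+n+j₀)
                               (m<n⇒m<1+n (subst (_ <_) Sr≡n+j₀
                                 (chosen-before-Sr inv (still⁻¹ chosen))))
    ; passed-clause-chosen = passed
    }
    where
    still : ∀ {l} → Chosen s l → Chosen s′ l
    still chosen = trans (x-keeps-C st _ _) chosen

    still⁻¹ : ∀ {l} → Chosen s′ l → Chosen s l
    still⁻¹ chosen = trans (sym (x-keeps-C st _ _)) chosen

    mq-chosen : Chosen s′ (m , q)
    mq-chosen = proj₂ (cTrans-x (proj₂ (step-local (P φ) st {C m q} (refl , refl))))

    passed : ∀ {j} → Passed s′ j → ∃ λ i → Chosen s′ (φ j i)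
    passed p with m<1+n⇒m<n∨m≡n (subst (_ <_) Sr′≡1+n+j₀ p)
    ... | inj₁ earlier =
      let i , chosen = passed-clause-chosen inv (subst (_ <_) (sym Sr≡n+j₀) earlier)
      in i , still chosen
    ... | inj₂ n+j≡n+j₀ with toℕ-injective (+-cancelˡ-≡ n _ _ n+j≡n+j₀)
    ...   | refl = i₀ , subst (Chosen s′) (sym φj₀i₀≡mq) mq-chosen

  Sr-at-b⇒satisfiable : ∀ {s} → BeforeE s → toℕ (s Sr) ≡ n + k → Satisfiable φ
  Sr-at-b⇒satisfiable inv Sr≡n+k = valuation inv , λ j →
    let i , chosen = passed-clause-chosen inv (subst (_ <_) (sym Sr≡n+k) (+-monoʳ-< n (toℕ<n j)))
    in i , litVal-true (valuation inv) (chosen-agrees inv chosen)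

  e-pending : ¬ Satisfiable φ → ∀ {s a s′} → BeforeE s → Step (P φ) s a s′ →
              a ≡ e ⊎ Independent (P φ) e a × BeforeE s′
  e-pending unsat {a = θ m q}   inv st = inj₂ (e-independent (λ ()) (λ ()) , θ-preserves st inv)
  e-pending unsat {a = x m q}   inv st = inj₂ (e-independent (λ ()) (λ ()) , x-preserves st inv)
  e-pending unsat {a = e}       inv st = inj₁ refl
  e-pending unsat {a = ē}       inv st =
    ⊥-elim (0≢1+n (trans (cong toℕ (sym (C̄*-unfired inv))) (proj₁ (step-local (P φ) st {C̄star} tt))))
  e-pending unsat {a = lam m q} inv st =
    ⊥-elim (0≢1+n (trans (cong toℕ (sym (Sl-at-l₀ inv))) (proj₁ (step-local (P φ) st {Sl} tt))))
  e-pending unsat {a = b}       inv st =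
    ⊥-elim (unsat (Sr-at-b⇒satisfiable inv (proj₁ (step-local (P φ) st {Sr} tt))))

lemma8p3 : ∀ {n k} (φ : Formula n k) → ¬ Satisfiable φ →
             ∀ (w : List (Act n)) → FullRun (P φ) w → first (P φ) w e
lemma8p3 φ unsat w (t , run , terminal) =
  invariant⇒first (P φ) e (BeforeE φ) (e-enabled φ) (e-pending φ unsat)
    (initial-BeforeE φ) run terminal
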